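{- With the notation of the context, the digraph $\Sigma=\mathrm{Cay}(R,S)$ is isomorphic to the coset digraph $\mathrm{Cos}(G,H,H\{g_1,g_2\}H)$, where $H\{g_1,g_2\}H=Hg_1H\cup Hg_2H$.
   Context: Let $P=\mathbb{F}_7\cup\{\infty\}$ and define permutations of $P\times P$: $a\colon(x,y)\mapsto(x+1,y)$, $b\colon(x,y)\mapsto(2x,y)$, $c\colon(x,y)\mapsto(x,y+1)$, $d\colon(x,y)\mapsto(x,2y)$, $s\colon(x,y)\mapsto\left(\frac{2x+1}{x+1},y\right)$, $t\colon(x,y)\mapsto\left(\frac{ -1}{x},y\right)$, $\alpha\colon(x,y)\mapsto\left(\frac{ -x}{x+1},\frac{ -y}{y+1}\right)$, $\beta\colon(x,y)\mapsto(y,x)$. Each coordinate map is a linear fractional transformation of $P$: $x\mapsto\frac{px+q}{rx+w}$ sends $\infty$ to $p/r$ (to $\infty$ if $r=0$) and, if $r\ne0$, sends $-w/r$ to $\infty$; $\infty+1=\infty$, $2\cdot\infty=\infty$. Permutations are composed left to right (the product $xy$ means first $x$, then $y$). Let $u=\beta^{ -1}s\beta$, $v=\beta^{ -1}t\beta$, $g_1=a^4c^5$, $g_2=a^2c^3d^2$, $R=\langle a,b,c,d\rangle$ (so $a^7=b^3=c^7=d^3=1$, $b^{ -1}ab=a^2$, $d^{ -1}cd=c^2$, and $R=\langle a,b\rangle\times\langle c,d\rangle$), $G=\langle a,b,c,d,t,v,\alpha,\beta\rangle$, $H=\langle s,t,u,v,\alpha,\beta\rangle$. Let $\gamma$ be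 the automorphism of $R$ given by conjugation by $\beta$ (it interchanges $a$ with $c$ and $b$ with $d$). Let $S_1=\{a,a^5,a^6b,a^6b^2\}$, $S_2=\{ab,(ab)^{ -1}\}$, $S_3=\{a^3,b,ab^2,a^4b^2\}$, $S_4=\{a^2b,(a^2b)^{ -1}\}$ and $S=(S_1\cup S_1^{ -1})(S_3\cup S_3^{ -1})^\gamma\cup(S_3\cup S_3^{ -1})(S_1\cup S_1^{ -1})^\gamma\cup S_1S_2^\gamma\cup S_2S_1^\gamma\cup S_1^{ -1}S_4^\gamma\cup S_4(S_1^{ -1})^\gamma$, where $X^{ -1}=\{x^{ -1}:x\in X\}$, $X^\gamma=\{\gamma(x):x\in X\}$, $XY=\{xy:x\in X,y\in Y\}$. $\mathrm{Cay}(R,S)$ has vertex set $R$ with $x\to y$ iff $yx^{ -1}\in S$. For a subgroup $H\le G$ and $D\subseteq G\setminus H$ a union of double cosets of $H$, $\mathrm{Cos}(G,H,D)$ has as vertices the right cosets of $H$ in $G$, with $Hx\to Hy$ iff $yx^{ -1}\in D$. -}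

module Defs where

open import Data.Nat using (ℕ; zero; suc; _+_; _*_)
open import Data.Nat.DivMod using (_mod_)
open import Data.Fin using (Fin; toℕ)
import Data.Fin as F
open import Data.Fin.Properties using () renaming (_≟_ to _≟F_)
open import Data.Product using (Σ; _×_; _,_; proj₁; proj₂)
open import Data.Sum using (_⊎_)
open import Data.List using (List; []; _∷_; _++_; map; concatMap)
open import Data.List.Membership.Propositional using (_∈_)
open import Data.List.Relation.Unary.All using (All)
open import Data.List.Relation.Unary.Any using (Any)
open import Relation.Binary.PropositionalEquality using (_≡_; refl; cong)
open import Relation.Nullary using (Dec; yes; no)
open import Function using (_∘_)

data P : Set where
  fin : Fin 7 → P
  ∞   : P

_≟P_ : (x y : P) → Dec (x ≡ y)
fin x ≟P fin y with x ≟F y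
... | yes refl = yes refl
... | no ne = no λ { refl → ne refl }
fin x ≟P ∞ = no λ ()
∞ ≟P fin y = no λ ()
∞ ≟P ∞ = yes refl

allF7 : List (Fin 7)
allF7 = Data.List.allFin 7
  where import Data.List

allP : List P
allP = ∞ ∷ map fin allF7

⌊_⌋ : ℕ → Fin 7
⌊ n ⌋ = n mod 7

invF : ℕ → ℕ
invF x = x * x * x * x * x

-- the linear fractional transformation x ↦ (p x + q)/(r x + w) of P
-- (coefficients p q r w are natural numbers read mod 7, so -1 is written 6)
lft : ℕ → ℕ → ℕ → ℕ → P → P
lft p q r w (fin x) with ⌊ r * toℕ x + w ⌋ ≟F ⌊ 0 ⌋
... | yes _ = ∞
... | no _  = fin ⌊ (p * toℕ x + q) * invF (r * toℕ x + w) ⌋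
lft p q r w ∞ with ⌊ r ⌋ ≟F ⌊ 0 ⌋
... | yes _ = ∞
... | no _  = fin ⌊ p * invF r ⌋

Point : Set
Point = P × P

_≟Pt_ : (x y : Point) → Dec (x ≡ y)
(x₁ , y₁) ≟Pt (x₂ , y₂) with x₁ ≟P x₂ | y₁ ≟P y₂
... | yes refl | yes refl = yes refl
... | no ne | _ = no λ { refl → ne refl }
... | yes _ | no ne = no λ { refl → ne refl }

allPoints : List Point
allPoints = concatMap (λ x → map (x ,_) allP) allP

Perm : Set
Perm = Point → Point

infix 4 _≈_
_≈_ : Perm → Perm → Set
f ≈ g = ∀ z → f z ≡ g z

infixl 7 _·_
-- product composed left to right: f · g means first f, then g
_·_ : Perm → Perm → Perm
(f · g) z = g (f z)

idP : Perm
idP z = z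

inv : Perm → Perm
inv f y = search allPoints
  where
  search : List Point → Point
  search [] = y
  search (x ∷ xs) with f x ≟Pt y
  ... | yes _ = x
  ... | no _  = search xs

_^_ : Perm → ℕ → Perm
f ^ zero = idP
f ^ suc n = f · (f ^ n)

onX : (P → P) → Perm
onX h (x , y) = (h x , y)

onY : (P → P) → Perm
onY h (x , y) = (x , h y)

a b c d s t α β : Perm
a = onX (lft 1 1 0 1)
b = onX (lft 2 0 0 1)
c = onY (lft 1 1 0 1)
d = onY (lft 2 0 0 1)
s = onX (lft 2 1 1 1)
t = onX (lft 0 6 1 0)
α (x , y) = (lft 6 0 1 1 x , lft 6 0 1 1 y)
β (x , y) = (y , x)

u v g₁ g₂ : Perm
u = inv β · s · β
v = inv β · t · β
g₁ = (a ^ 4) · (c ^ 5)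
g₂ = (a ^ 2) · (c ^ 3) · (d ^ 2)

data Letter (gens : List Perm) : Perm → Set where
  gen  : ∀ {g} → g ∈ gens → Letter gens g
  gen⁻ : ∀ {g} → g ∈ gens → Letter gens (inv g)

prod : List Perm → Perm
prod [] = idP
prod (x ∷ w) = x · prod w

⟨_⟩ : List Perm → Perm → Set
⟨ gens ⟩ f = Σ (List Perm) λ w → All (Letter gens) w × (prod w ≈ f)

InR InG InH : Perm → Set
InR = ⟨ a ∷ b ∷ c ∷ d ∷ [] ⟩
InG = ⟨ a ∷ b ∷ c ∷ d ∷ t ∷ v ∷ α ∷ β ∷ [] ⟩
InH = ⟨ s ∷ t ∷ u ∷ v ∷ α ∷ β ∷ [] ⟩

γ : Perm → Perm
γ x = inv β · x · β

invs : List Perm → List Perm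
invs = map inv

_⊗_ : List Perm → List Perm → List Perm
X ⊗ Y = concatMap (λ x → map (x ·_) Y) X

_ᵞ : List Perm → List Perm
X ᵞ = map γ X

S₁ S₂ S₃ S₄ S₁± S₃± Sconn : List Perm
S₁ = a ∷ (a ^ 5) ∷ (a ^ 6) · b ∷ (a ^ 6) · (b ^ 2) ∷ []
S₂ = a · b ∷ inv (a · b) ∷ []
S₃ = (a ^ 3) ∷ b ∷ a · (b ^ 2) ∷ (a ^ 4) · (b ^ 2) ∷ []
S₄ = (a ^ 2) · b ∷ inv ((a ^ 2) · b) ∷ []
S₁± = S₁ ++ invs S₁
S₃± = S₃ ++ invs S₃
Sconn = (S₁± ⊗ (S₃± ᵞ)) ++ (S₃± ⊗ (S₁± ᵞ)) ++ (S₁ ⊗ (S₂ ᵞ))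
     ++ (S₂ ⊗ (S₁ ᵞ)) ++ (invs S₁ ⊗ (S₄ ᵞ)) ++ (S₄ ⊗ (invs S₁ ᵞ))

CayArc : Perm → Perm → Set
CayArc x y = Any (λ σ → (y · inv x) ≈ σ) Sconn

InD : Perm → Set
InD z = Σ Perm λ h → Σ Perm λ h' → InH h × InH h' ×
        ((z ≈ h · g₁ · h') ⊎ (z ≈ h · g₂ · h'))

SameCoset : Perm → Perm → Set
SameCoset x y = InH (y · inv x)

CosArc : Perm → Perm → Set
CosArc x y = InD (y · inv x)

record CayCosIso : Set where
  field
    φ        : (r : Perm) → InR r → Perm
    φ-inG    : ∀ r (p : InR r) → InG (φ r p)
    φ-wd     : ∀ r (p : InR r) r' (p' : InR r') → r ≈ r' → SameCoset (φ r p) (φ r' p')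
    φ-inj    : ∀ r (p : InR r) r' (p' : InR r') → SameCoset (φ r p) (φ r' p') → r ≈ r'
    φ-surj   : ∀ g → InG g → Σ Perm λ r → Σ (InR r) λ p → SameCoset (φ r p) g
    φ-arc    : ∀ r (p : InR r) r' (p' : InR r') → CayArc r r' → CosArc (φ r p) (φ r' p')
    φ-arc⁻   : ∀ r (p : InR r) r' (p' : InR r') → CosArc (φ r p) (φ r' p') → CayArc r r'

module Submission where

-- Each right coset of H in G contains exactly one element of R.  Existence: for
-- r ∈ R and a generator x of H, r·x = h·r′ with h ∈ H and r′ ∈ R (tabulated below),
-- so G = HR.  Uniqueness: H centralises σ = σ₀ × σ₀, σ₀ x = (6x + 5)/(5x + 1),
-- so h·r = r′ forces r⁻¹σr = r′⁻¹σr′, and the 21 conjugates of σ₀ by the affine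
-- maps x ↦ 2ⁱx + q are pairwise distinct.  Identifying H\G with R, right
-- multiplication by H becomes an action on R, the set of r with Hr ⊆ Hg₁H ∪ Hg₂H
-- is the union of the orbits of g₁ and g₂, and a finite computation shows that this
-- union is S.  Hence r ↦ Hr is the required isomorphism.

open import Defs
open import Data.Empty using (⊥-elim)
open import Data.Bool using (T)
open import Data.Fin using (Fin; zero; suc; toℕ; #_)
open import Data.Fin.Properties using (all?) renaming (_≟_ to _≟ᵃ_)
open import Data.List using (List; []; _∷_; _++_; map; concatMap; replicate)
open import Data.List.Membership.Propositional using (_∈_)
open import Data.List.Membership.Propositional.Properties using (∈-++⁺ˡ)
open import Data.List.Relation.Binary.Pointwise using (Pointwise; []; _∷_; ++⁺)
open import Data.List.Relation.Unary.All as All using (All; []; _∷_)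
open import Data.List.Relation.Unary.All.Properties using (replicate⁺) renaming (++⁺ to All-++⁺)
open import Data.List.Relation.Unary.Any as Any using (Any; here; there)
open import Data.Maybe using (Maybe; just; nothing; is-just; fromMaybe)
open import Data.Nat using (ℕ; zero; suc; _+_; _*_; _∸_) renaming (_^_ to _^ℕ_)
open import Data.Nat.DivMod using (_mod_; _/_; _%_)
open import Data.Product using (Σ; _×_; _,_; proj₁; proj₂)
open import Data.Product.Properties using (≡-dec)
open import Data.Sum using (_⊎_; inj₁; inj₂)
open import Data.Unit using (tt)
open import Data.Vec using (Vec; []; _∷_; lookup)
open import Function using (id)
open import Relation.Binary.Definitions using (DecidableEquality)
open import Relation.Binary.PropositionalEquality
open import Relation.Nullary using (Dec; yes; no)
open import Relation.Nullary.Decidable using (True; toWitness; map′; T?; _×-dec_; _→-dec_)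

∀P? : {Q : P → Set} → ((p : P) → Dec (Q p)) → Dec ((p : P) → Q p)
∀P? Q? with Q? ∞ | all? (λ x → Q? (fin x))
... | yes q∞ | yes qfin = yes λ { ∞ → q∞ ; (fin x) → qfin x }
... | no ¬q∞ | _ = no λ q → ¬q∞ (q ∞)
... | yes _ | no ¬qfin = no λ q → ¬qfin (λ x → q (fin x))

∀Point? : {Q : Point → Set} → ((z : Point) → Dec (Q z)) → Dec ((z : Point) → Q z)
∀Point? Q? = map′ (λ q z → q (proj₁ z) (proj₂ z)) (λ q x y → q (x , y)) (∀P? λ x → ∀P? λ y → Q? (x , y))

≈-by-evaluation : (f g : Perm) → {True (∀Point? λ z → f z ≟Pt g z)} → f ≈ g
≈-by-evaluation f g {ok} = toWitness ok

abstract
  ∈-allPoints : (z : Point) → z ∈ allPoints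
  ∈-allPoints = toWitness {a? = ∀Point? λ z → Any.any? (z ≟Pt_) allPoints} tt

-- `inv` searches allPoints inside an anonymous where-block, so its behaviour can only
-- be exposed by abstracting the 64 comparisons it performs, one after the other.
inv-spec : (f : Perm) (y : Point) → f (inv f y) ≡ y ⊎ All (λ x → f x ≢ y) allPoints
inv-spec f y with f (∞ , ∞) ≟Pt y
... | yes e = inj₁ e
... | no ¬0 with f (∞ , (fin zero)) ≟Pt y
... | yes e = inj₁ e
... | no ¬1 with f (∞ , (fin (suc zero))) ≟Pt y
... | yes e = inj₁ e
... | no ¬2 with f (∞ , (fin (suc (suc zero)))) ≟Pt y
... | yes e = inj₁ e
... | no ¬3 with f (∞ , (fin (suc (suc (suc zero))))) ≟Pt y
... | yes e = inj₁ e
... | no ¬4 with f (∞ , (fin (suc (suc (suc (suc zero)))))) ≟Pt y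
... | yes e = inj₁ e
... | no ¬5 with f (∞ , (fin (suc (suc (suc (suc (suc zero))))))) ≟Pt y
... | yes e = inj₁ e
... | no ¬6 with f (∞ , (fin (suc (suc (suc (suc (suc (suc zero)))))))) ≟Pt y
... | yes e = inj₁ e
... | no ¬7 with f ((fin zero) , ∞) ≟Pt y
... | yes e = inj₁ e
... | no ¬8 with f ((fin zero) , (fin zero)) ≟Pt y
... | yes e = inj₁ e
... | no ¬9 with f ((fin zero) , (fin (suc zero))) ≟Pt y
... | yes e = inj₁ e
... | no ¬10 with f ((fin zero) , (fin (suc (suc zero)))) ≟Pt y
... | yes e = inj₁ e
... | no ¬11 with f ((fin zero) , (fin (suc (suc (suc zero))))) ≟Pt y
... | yes e = inj₁ e
... | no ¬12 with f ((fin zero) , (fin (suc (suc (suc (suc zero)))))) ≟Pt y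
... | yes e = inj₁ e
... | no ¬13 with f ((fin zero) , (fin (suc (suc (suc (suc (suc zero))))))) ≟Pt y
... | yes e = inj₁ e
... | no ¬14 with f ((fin zero) , (fin (suc (suc (suc (suc (suc (suc zero)))))))) ≟Pt y
... | yes e = inj₁ e
... | no ¬15 with f ((fin (suc zero)) , ∞) ≟Pt y
... | yes e = inj₁ e
... | no ¬16 with f ((fin (suc zero)) , (fin zero)) ≟Pt y
... | yes e = inj₁ e
... | no ¬17 with f ((fin (suc zero)) , (fin (suc zero))) ≟Pt y
... | yes e = inj₁ e
... | no ¬18 with f ((fin (suc zero)) , (fin (suc (suc zero)))) ≟Pt y
... | yes e = inj₁ e
... | no ¬19 with f ((fin (suc zero)) , (fin (suc (suc (suc zero))))) ≟Pt y
... | yes e = inj₁ e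
... | no ¬20 with f ((fin (suc zero)) , (fin (suc (suc (suc (suc zero)))))) ≟Pt y
... | yes e = inj₁ e
... | no ¬21 with f ((fin (suc zero)) , (fin (suc (suc (suc (suc (suc zero))))))) ≟Pt y
... | yes e = inj₁ e
... | no ¬22 with f ((fin (suc zero)) , (fin (suc (suc (suc (suc (suc (suc zero)))))))) ≟Pt y
... | yes e = inj₁ e
... | no ¬23 with f ((fin (suc (suc zero))) , ∞) ≟Pt y
... | yes e = inj₁ e
... | no ¬24 with f ((fin (suc (suc zero))) , (fin zero)) ≟Pt y
... | yes e = inj₁ e
... | no ¬25 with f ((fin (suc (suc zero))) , (fin (suc zero))) ≟Pt y
... | yes e = inj₁ e
... | no ¬26 with f ((fin (suc (suc zero))) , (fin (suc (suc zero)))) ≟Pt y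
... | yes e = inj₁ e
... | no ¬27 with f ((fin (suc (suc zero))) , (fin (suc (suc (suc zero))))) ≟Pt y
... | yes e = inj₁ e
... | no ¬28 with f ((fin (suc (suc zero))) , (fin (suc (suc (suc (suc zero)))))) ≟Pt y
... | yes e = inj₁ e
... | no ¬29 with f ((fin (suc (suc zero))) , (fin (suc (suc (suc (suc (suc zero))))))) ≟Pt y
... | yes e = inj₁ e
... | no ¬30 with f ((fin (suc (suc zero))) , (fin (suc (suc (suc (suc (suc (suc zero)))))))) ≟Pt y
... | yes e = inj₁ e
... | no ¬31 with f ((fin (suc (suc (suc zero)))) , ∞) ≟Pt y
... | yes e = inj₁ e
... | no ¬32 with f ((fin (suc (suc (suc zero)))) , (fin zero)) ≟Pt y
... | yes e = inj₁ e
... | no ¬33 with f ((fin (suc (suc (suc zero)))) , (fin (suc zero))) ≟Pt y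
... | yes e = inj₁ e
... | no ¬34 with f ((fin (suc (suc (suc zero)))) , (fin (suc (suc zero)))) ≟Pt y
... | yes e = inj₁ e
... | no ¬35 with f ((fin (suc (suc (suc zero)))) , (fin (suc (suc (suc zero))))) ≟Pt y
... | yes e = inj₁ e
... | no ¬36 with f ((fin (suc (suc (suc zero)))) , (fin (suc (suc (suc (suc zero)))))) ≟Pt y
... | yes e = inj₁ e
... | no ¬37 with f ((fin (suc (suc (suc zero)))) , (fin (suc (suc (suc (suc (suc zero))))))) ≟Pt y
... | yes e = inj₁ e
... | no ¬38 with f ((fin (suc (suc (suc zero)))) , (fin (suc (suc (suc (suc (suc (suc zero)))))))) ≟Pt y
... | yes e = inj₁ e
... | no ¬39 with f ((fin (suc (suc (suc (suc zero))))) , ∞) ≟Pt y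
... | yes e = inj₁ e
... | no ¬40 with f ((fin (suc (suc (suc (suc zero))))) , (fin zero)) ≟Pt y
... | yes e = inj₁ e
... | no ¬41 with f ((fin (suc (suc (suc (suc zero))))) , (fin (suc zero))) ≟Pt y
... | yes e = inj₁ e
... | no ¬42 with f ((fin (suc (suc (suc (suc zero))))) , (fin (suc (suc zero)))) ≟Pt y
... | yes e = inj₁ e
... | no ¬43 with f ((fin (suc (suc (suc (suc zero))))) , (fin (suc (suc (suc zero))))) ≟Pt y
... | yes e = inj₁ e
... | no ¬44 with f ((fin (suc (suc (suc (suc zero))))) , (fin (suc (suc (suc (suc zero)))))) ≟Pt y
... | yes e = inj₁ e
... | no ¬45 with f ((fin (suc (suc (suc (suc zero))))) , (fin (suc (suc (suc (suc (suc zero))))))) ≟Pt y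
... | yes e = inj₁ e
... | no ¬46 with f ((fin (suc (suc (suc (suc zero))))) , (fin (suc (suc (suc (suc (suc (suc zero)))))))) ≟Pt y
... | yes e = inj₁ e
... | no ¬47 with f ((fin (suc (suc (suc (suc (suc zero)))))) , ∞) ≟Pt y
... | yes e = inj₁ e
... | no ¬48 with f ((fin (suc (suc (suc (suc (suc zero)))))) , (fin zero)) ≟Pt y
... | yes e = inj₁ e
... | no ¬49 with f ((fin (suc (suc (suc (suc (suc zero)))))) , (fin (suc zero))) ≟Pt y
... | yes e = inj₁ e
... | no ¬50 with f ((fin (suc (suc (suc (suc (suc zero)))))) , (fin (suc (suc zero)))) ≟Pt y
... | yes e = inj₁ e
... | no ¬51 with f ((fin (suc (suc (suc (suc (suc zero)))))) , (fin (suc (suc (suc zero))))) ≟Pt y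
... | yes e = inj₁ e
... | no ¬52 with f ((fin (suc (suc (suc (suc (suc zero)))))) , (fin (suc (suc (suc (suc zero)))))) ≟Pt y
... | yes e = inj₁ e
... | no ¬53 with f ((fin (suc (suc (suc (suc (suc zero)))))) , (fin (suc (suc (suc (suc (suc zero))))))) ≟Pt y
... | yes e = inj₁ e
... | no ¬54 with f ((fin (suc (suc (suc (suc (suc zero)))))) , (fin (suc (suc (suc (suc (suc (suc zero)))))))) ≟Pt y
... | yes e = inj₁ e
... | no ¬55 with f ((fin (suc (suc (suc (suc (suc (suc zero))))))) , ∞) ≟Pt y
... | yes e = inj₁ e
... | no ¬56 with f ((fin (suc (suc (suc (suc (suc (suc zero))))))) , (fin zero)) ≟Pt y
... | yes e = inj₁ e
... | no ¬57 with f ((fin (suc (suc (suc (suc (suc (suc zero))))))) , (fin (suc zero))) ≟Pt y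
... | yes e = inj₁ e
... | no ¬58 with f ((fin (suc (suc (suc (suc (suc (suc zero))))))) , (fin (suc (suc zero)))) ≟Pt y
... | yes e = inj₁ e
... | no ¬59 with f ((fin (suc (suc (suc (suc (suc (suc zero))))))) , (fin (suc (suc (suc zero))))) ≟Pt y
... | yes e = inj₁ e
... | no ¬60 with f ((fin (suc (suc (suc (suc (suc (suc zero))))))) , (fin (suc (suc (suc (suc zero)))))) ≟Pt y
... | yes e = inj₁ e
... | no ¬61 with f ((fin (suc (suc (suc (suc (suc (suc zero))))))) , (fin (suc (suc (suc (suc (suc zero))))))) ≟Pt y
... | yes e = inj₁ e
... | no ¬62 with f ((fin (suc (suc (suc (suc (suc (suc zero))))))) , (fin (suc (suc (suc (suc (suc (suc zero)))))))) ≟Pt y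
... | yes e = inj₁ e
... | no ¬63 = inj₂
  ( ¬0 ∷ ¬1 ∷ ¬2 ∷ ¬3 ∷ ¬4 ∷ ¬5 ∷ ¬6 ∷ ¬7 ∷ ¬8 ∷ ¬9 ∷ ¬10 ∷ ¬11 ∷ ¬12 ∷ ¬13 ∷ ¬14 ∷ ¬15
  ∷ ¬16 ∷ ¬17 ∷ ¬18 ∷ ¬19 ∷ ¬20 ∷ ¬21 ∷ ¬22 ∷ ¬23 ∷ ¬24 ∷ ¬25 ∷ ¬26 ∷ ¬27 ∷ ¬28 ∷ ¬29 ∷ ¬30 ∷ ¬31
  ∷ ¬32 ∷ ¬33 ∷ ¬34 ∷ ¬35 ∷ ¬36 ∷ ¬37 ∷ ¬38 ∷ ¬39 ∷ ¬40 ∷ ¬41 ∷ ¬42 ∷ ¬43 ∷ ¬44 ∷ ¬45 ∷ ¬46 ∷ ¬47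
  ∷ ¬48 ∷ ¬49 ∷ ¬50 ∷ ¬51 ∷ ¬52 ∷ ¬53 ∷ ¬54 ∷ ¬55 ∷ ¬56 ∷ ¬57 ∷ ¬58 ∷ ¬59 ∷ ¬60 ∷ ¬61 ∷ ¬62 ∷ ¬63
  ∷ [])

inv-unique : (f g : Perm) → (∀ z → g (f z) ≡ z) → (∀ y → f (g y) ≡ y) → inv f ≈ g
inv-unique f g gf fg y with inv-spec f y
... | inj₁ f-inv = trans (sym (gf (inv f y))) (cong g f-inv)
... | inj₂ missed = ⊥-elim (All.lookup missed (∈-allPoints (g y)) (fg y))

Aff : Set
Aff = Fin 21

-- j = 7i + q stands for x ↦ 2ⁱx + q (i < 3); 2 has order 3 modulo 7.
exponent translation : Aff → ℕ
exponent j = toℕ j / 7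
translation j = toℕ j % 7

mkAff : ℕ → ℕ → Aff
mkAff i q = ((i % 3) * 7 + q % 7) mod 21

affine : Aff → P → P
affine j = lft (2 ^ℕ exponent j) (translation j) 0 1

idᵃ : Aff
idᵃ = # 0

infixl 7 _⋆ᵃ_
_⋆ᵃ_ : Aff → Aff → Aff
j ⋆ᵃ k = mkAff (exponent j + exponent k) (2 ^ℕ exponent k * translation j + translation k)

_⁻¹ᵃ : Aff → Aff
j ⁻¹ᵃ = mkAff (3 ∸ exponent j) (2 ^ℕ (3 ∸ exponent j) * (7 ∸ translation j))

abstract
  affine-⋆ᵃ : ∀ j k p → affine k (affine j p) ≡ affine (j ⋆ᵃ k) p
  affine-⋆ᵃ = toWitness {a? = all? λ j → all? λ k → ∀P? λ p → affine k (affine j p) ≟P affine (j ⋆ᵃ k) p} tt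

  affine-idᵃ : ∀ p → affine idᵃ p ≡ p
  affine-idᵃ = toWitness {a? = ∀P? λ p → affine idᵃ p ≟P p} tt

  ⁻¹ᵃ-inverseˡ : ∀ j → j ⁻¹ᵃ ⋆ᵃ j ≡ idᵃ
  ⁻¹ᵃ-inverseˡ = toWitness {a? = all? λ j → j ⁻¹ᵃ ⋆ᵃ j ≟ᵃ idᵃ} tt

  ⁻¹ᵃ-inverseʳ : ∀ j → j ⋆ᵃ j ⁻¹ᵃ ≡ idᵃ
  ⁻¹ᵃ-inverseʳ = toWitness {a? = all? λ j → j ⋆ᵃ j ⁻¹ᵃ ≟ᵃ idᵃ} tt

affine-cancel : ∀ j k p → j ⋆ᵃ k ≡ idᵃ → affine k (affine j p) ≡ p
affine-cancel j k p jk≡id = begin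
  affine k (affine j p) ≡⟨ affine-⋆ᵃ j k p ⟩
  affine (j ⋆ᵃ k) p     ≡⟨ cong (λ i → affine i p) jk≡id ⟩
  affine idᵃ p          ≡⟨ affine-idᵃ p ⟩
  p                     ∎
  where open ≡-Reasoning

Lab : Set
Lab = Aff × Aff

infix 4 _≟ᴸ_
_≟ᴸ_ : DecidableEquality Lab
_≟ᴸ_ = ≡-dec _≟ᵃ_ _≟ᵃ_

∀Lab? : {Q : Lab → Set} → ((l : Lab) → Dec (Q l)) → Dec ((l : Lab) → Q l)
∀Lab? Q? = map′ (λ q l → q (proj₁ l) (proj₂ l)) (λ q j k → q (j , k)) (all? λ j → all? λ k → Q? (j , k))

⟦_⟧ : Lab → Perm
⟦ j , k ⟧ (x , y) = affine j x , affine k y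

ε : Lab
ε = idᵃ , idᵃ

infixl 7 _⋆_
_⋆_ : Lab → Lab → Lab
(j , k) ⋆ (j′ , k′) = j ⋆ᵃ j′ , k ⋆ᵃ k′

_⁻¹ : Lab → Lab
(j , k) ⁻¹ = j ⁻¹ᵃ , k ⁻¹ᵃ

⟦⟧-⋆ : ∀ l m → ⟦ l ⟧ · ⟦ m ⟧ ≈ ⟦ l ⋆ m ⟧
⟦⟧-⋆ (j , k) (j′ , k′) (x , y) = cong₂ _,_ (affine-⋆ᵃ j j′ x) (affine-⋆ᵃ k k′ y)

⟦ε⟧ : ⟦ ε ⟧ ≈ idP
⟦ε⟧ (x , y) = cong₂ _,_ (affine-idᵃ x) (affine-idᵃ y)

⟦⟧-inverseˡ : ∀ l z → ⟦ l ⁻¹ ⟧ (⟦ l ⟧ z) ≡ z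
⟦⟧-inverseˡ (j , k) (x , y) =
  cong₂ _,_ (affine-cancel j (j ⁻¹ᵃ) x (⁻¹ᵃ-inverseʳ j)) (affine-cancel k (k ⁻¹ᵃ) y (⁻¹ᵃ-inverseʳ k))

⟦⟧-inverseʳ : ∀ l z → ⟦ l ⟧ (⟦ l ⁻¹ ⟧ z) ≡ z
⟦⟧-inverseʳ (j , k) (x , y) =
  cong₂ _,_ (affine-cancel (j ⁻¹ᵃ) j x (⁻¹ᵃ-inverseˡ j)) (affine-cancel (k ⁻¹ᵃ) k y (⁻¹ᵃ-inverseˡ k))

Labelled : Perm → Set
Labelled f = Σ Lab λ l → f ≈ ⟦ l ⟧

inv-⟦⟧ : ∀ {f} l → f ≈ ⟦ l ⟧ → inv f ≈ ⟦ l ⁻¹ ⟧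
inv-⟦⟧ {f} l f≈l = inv-unique f ⟦ l ⁻¹ ⟧
  (λ z → trans (cong ⟦ l ⁻¹ ⟧ (f≈l z)) (⟦⟧-inverseˡ l z))
  (λ y → trans (f≈l (⟦ l ⁻¹ ⟧ y)) (⟦⟧-inverseʳ l y))

inv-cancelˡ : ∀ {f} → Labelled f → ∀ z → inv f (f z) ≡ z
inv-cancelˡ {f} (l , f≈l) z = trans (inv-⟦⟧ l f≈l (f z)) (trans (cong ⟦ l ⁻¹ ⟧ (f≈l z)) (⟦⟧-inverseˡ l z))

inv-cancelʳ : ∀ {f} → Labelled f → ∀ z → f (inv f z) ≡ z
inv-cancelʳ {f} (l , f≈l) z = trans (f≈l (inv f z)) (trans (cong ⟦ l ⟧ (inv-⟦⟧ l f≈l z)) (⟦⟧-inverseʳ l z))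

labelled-· : ∀ {f g} → Labelled f → Labelled g → Labelled (f · g)
labelled-· {f} {g} (l , f≈l) (m , g≈m) = l ⋆ m , λ z → trans (cong g (f≈l z)) (trans (g≈m (⟦ l ⟧ z)) (⟦⟧-⋆ l m z))

labelled-inv : ∀ {f} → Labelled f → Labelled (inv f)
labelled-inv (l , f≈l) = l ⁻¹ , inv-⟦⟧ l f≈l

labelled-prod : ∀ {w} → All Labelled w → Labelled (prod w)
labelled-prod [] = ε , λ z → sym (⟦ε⟧ z)
labelled-prod (f∈R ∷ w∈R) = labelled-· f∈R (labelled-prod w∈R)

Rgens Hgens Ggens : List Perm
Rgens = a ∷ b ∷ c ∷ d ∷ []
Hgens = s ∷ t ∷ u ∷ v ∷ α ∷ β ∷ []
Ggens = a ∷ b ∷ c ∷ d ∷ t ∷ v ∷ α ∷ β ∷ []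

aᴸ bᴸ cᴸ dᴸ : Lab
aᴸ = # 1 , # 0
bᴸ = # 7 , # 0
cᴸ = # 0 , # 1
dᴸ = # 0 , # 7

abstract
  a≈ : a ≈ ⟦ aᴸ ⟧
  a≈ = ≈-by-evaluation a ⟦ aᴸ ⟧

  b≈ : b ≈ ⟦ bᴸ ⟧
  b≈ = ≈-by-evaluation b ⟦ bᴸ ⟧

  c≈ : c ≈ ⟦ cᴸ ⟧
  c≈ = ≈-by-evaluation c ⟦ cᴸ ⟧

  d≈ : d ≈ ⟦ dᴸ ⟧
  d≈ = ≈-by-evaluation d ⟦ dᴸ ⟧

R-generator : ∀ {g} → g ∈ Rgens → Labelled g
R-generator (here refl) = aᴸ , a≈
R-generator (there (here refl)) = bᴸ , b≈
R-generator (there (there (here refl))) = cᴸ , c≈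
R-generator (there (there (there (here refl)))) = dᴸ , d≈

labelled-R-letter : ∀ {g} → Letter Rgens g → Labelled g
labelled-R-letter (gen g∈) = R-generator g∈
labelled-R-letter (gen⁻ g∈) = labelled-inv (R-generator g∈)

labelled-R : ∀ {r} → InR r → Labelled r
labelled-R (w , letters , w≈r) with labelled-prod (All.map labelled-R-letter letters)
... | l , w≈l = l , λ z → trans (sym (w≈r z)) (w≈l z)

R-word : Lab → List Perm
R-word (j , k) = replicate (exponent j) b ++ replicate (translation j) a
              ++ replicate (exponent k) d ++ replicate (translation k) c

R-word-letters : ∀ l → All (Letter Rgens) (R-word l)
R-word-letters (j , k) =
  All-++⁺ (replicate⁺ (exponent j) (gen b∈)) (All-++⁺ (replicate⁺ (translation j) (gen a∈))
    (All-++⁺ (replicate⁺ (exponent k) (gen d∈)) (replicate⁺ (translation k) (gen c∈))))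
  where
  a∈ = here refl
  b∈ = there (here refl)
  c∈ = there (there (here refl))
  d∈ = there (there (there (here refl)))

R-word-labelled : ∀ l → Labelled (prod (R-word l))
R-word-labelled l = labelled-prod (All.map labelled-R-letter (R-word-letters l))

abstract
  R-word-label : ∀ l → proj₁ (R-word-labelled l) ≡ l
  R-word-label = toWitness {a? = ∀Lab? λ l → proj₁ (R-word-labelled l) ≟ᴸ l} tt

⟦⟧∈R : ∀ l → InR ⟦ l ⟧
⟦⟧∈R l = R-word l , R-word-letters l ,
  λ z → trans (proj₂ (R-word-labelled l) z) (cong (λ m → ⟦ m ⟧ z) (R-word-label l))

R⊆G : ∀ {r} → InR r → InG r
R⊆G (w , letters , w≈r) = w , All.map lift letters , w≈r
  where
  lift : ∀ {g} → Letter Rgens g → Letter Ggens g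
  lift (gen g∈) = gen (∈-++⁺ˡ g∈)
  lift (gen⁻ g∈) = gen⁻ (∈-++⁺ˡ g∈)

module _ {X : Set} (gen : X → Perm) where

  word : List X → Perm
  word xs = prod (map gen xs)

  word-++ : ∀ xs ys z → word (xs ++ ys) z ≡ word ys (word xs z)
  word-++ [] ys z = refl
  word-++ (x ∷ xs) ys z = word-++ xs ys (gen x z)

  spell : ∀ {gens} → (∀ {g} → Letter gens g → Σ (List X) λ xs → word xs ≈ g) →
          ∀ {w} → All (Letter gens) w → Σ (List X) λ xs → word xs ≈ prod w
  spell spell-letter [] = [] , λ _ → refl
  spell spell-letter {g ∷ _} (ℓ ∷ ℓs) with spell-letter ℓ | spell spell-letter ℓs
  ... | xs , xs≈g | ys , ys≈w =
    xs ++ ys , λ z → trans (word-++ xs ys z) (trans (cong (word ys) (xs≈g z)) (ys≈w (g z)))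

-- Moving the generators of H past R

sᴾ tᴾ αᴾ σᴾ : P → P
sᴾ = lft 2 1 1 1
tᴾ = lft 0 6 1 0
αᴾ = lft 6 0 1 1
σᴾ = lft 6 5 5 1

data STLetter : Set where
  ṡ ṫ : STLetter

runST : List STLetter → P → P
runST [] p = p
runST (ṡ ∷ w) p = runST w (sᴾ p)
runST (ṫ ∷ w) p = runST w (tᴾ p)

target : ∀ {A : Set} → Vec (Aff × A) 21 → Aff → Aff
target table j = proj₁ (lookup table j)

witness : ∀ {A : Set} → Vec (Aff × A) 21 → Aff → A
witness table j = proj₂ (lookup table j)

Factorisation : (P → P) → (P → P) → Vec (Aff × List STLetter) 21 → Set
Factorisation f g table =
  ∀ j p → f (affine j p) ≡ affine (target table j) (g (runST (witness table j) p))

factorisation? : ∀ f g table → Dec (Factorisation f g table)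
factorisation? f g table =
  all? λ j → ∀P? λ p → f (affine j p) ≟P affine (target table j) (g (runST (witness table j) p))

sTable : Vec (Aff × List STLetter) 21
sTable =
    (# 0  , ṡ ∷ [])
  ∷ (# 17 , ṡ ∷ ṡ ∷ ṫ ∷ [])
  ∷ (# 8  , ṡ ∷ ṡ ∷ [])
  ∷ (# 18 , ṡ ∷ ṫ ∷ [])
  ∷ (# 3  , ṡ ∷ ṡ ∷ ṡ ∷ [])
  ∷ (# 1  , ṫ ∷ ṡ ∷ [])
  ∷ (# 2  , ṫ ∷ [])
  ∷ (# 10 , ṡ ∷ ṫ ∷ [])
  ∷ (# 15 , ṡ ∷ [])
  ∷ (# 20 , ṡ ∷ ṡ ∷ ṡ ∷ [])
  ∷ (# 13 , ṡ ∷ ṡ ∷ ṫ ∷ [])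
  ∷ (# 19 , ṫ ∷ ṡ ∷ [])
  ∷ (# 5  , ṡ ∷ ṡ ∷ [])
  ∷ (# 16 , ṫ ∷ [])
  ∷ (# 4  , ṡ ∷ ṡ ∷ ṫ ∷ [])
  ∷ (# 6  , ṡ ∷ ṫ ∷ [])
  ∷ (# 7  , ṫ ∷ ṡ ∷ [])
  ∷ (# 12 , ṡ ∷ [])
  ∷ (# 14 , ṡ ∷ ṡ ∷ [])
  ∷ (# 11 , ṡ ∷ ṡ ∷ ṡ ∷ [])
  ∷ (# 9  , ṫ ∷ [])
  ∷ []

tTable : Vec (Aff × List STLetter) 21
tTable =
    (# 0  , ṫ ∷ [])
  ∷ (# 5  , ṡ ∷ [])
  ∷ (# 15 , ṡ ∷ ṡ ∷ ṫ ∷ [])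
  ∷ (# 13 , ṡ ∷ ṡ ∷ [])
  ∷ (# 16 , ṡ ∷ ṫ ∷ [])
  ∷ (# 1  , ṡ ∷ ṡ ∷ ṡ ∷ [])
  ∷ (# 6  , ṫ ∷ ṡ ∷ [])
  ∷ (# 14 , ṫ ∷ [])
  ∷ (# 8  , ṡ ∷ ṫ ∷ [])
  ∷ (# 20 , ṡ ∷ [])
  ∷ (# 18 , ṡ ∷ ṡ ∷ ṡ ∷ [])
  ∷ (# 11 , ṡ ∷ ṡ ∷ ṫ ∷ [])
  ∷ (# 17 , ṫ ∷ ṡ ∷ [])
  ∷ (# 3  , ṡ ∷ ṡ ∷ [])
  ∷ (# 7  , ṫ ∷ [])
  ∷ (# 2  , ṡ ∷ ṡ ∷ ṫ ∷ [])
  ∷ (# 4  , ṡ ∷ ṫ ∷ [])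
  ∷ (# 12 , ṫ ∷ ṡ ∷ [])
  ∷ (# 10 , ṡ ∷ [])
  ∷ (# 19 , ṡ ∷ ṡ ∷ [])
  ∷ (# 9  , ṡ ∷ ṡ ∷ ṡ ∷ [])
  ∷ []

αTable : Vec (Aff × List STLetter) 21
αTable =
    (# 0  , [])
  ∷ (# 15 , ṫ ∷ ṡ ∷ [])
  ∷ (# 12 , ṡ ∷ [])
  ∷ (# 14 , ṡ ∷ ṡ ∷ ṫ ∷ [])
  ∷ (# 4  , ṡ ∷ ṡ ∷ [])
  ∷ (# 6  , ṫ ∷ [])
  ∷ (# 5  , ṡ ∷ ṫ ∷ [])
  ∷ (# 10 , ṡ ∷ ṡ ∷ ṫ ∷ [])
  ∷ (# 17 , [])
  ∷ (# 19 , ṡ ∷ ṡ ∷ [])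
  ∷ (# 7  , ṫ ∷ ṡ ∷ [])
  ∷ (# 20 , ṫ ∷ [])
  ∷ (# 2  , ṡ ∷ [])
  ∷ (# 16 , ṡ ∷ ṫ ∷ [])
  ∷ (# 3  , ṫ ∷ ṡ ∷ [])
  ∷ (# 1  , ṡ ∷ ṡ ∷ ṫ ∷ [])
  ∷ (# 13 , ṫ ∷ [])
  ∷ (# 8  , [])
  ∷ (# 18 , ṡ ∷ [])
  ∷ (# 9  , ṡ ∷ ṡ ∷ [])
  ∷ (# 11 , ṡ ∷ ṫ ∷ [])
  ∷ []

abstract
  sTable-factorises : Factorisation sᴾ id sTable
  sTable-factorises = toWitness {a? = factorisation? sᴾ id sTable} tt

  tTable-factorises : Factorisation tᴾ id tTable
  tTable-factorises = toWitness {a? = factorisation? tᴾ id tTable} tt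

  αTable-factorises : Factorisation αᴾ αᴾ αTable
  αTable-factorises = toWitness {a? = factorisation? αᴾ αᴾ αTable} tt

data HLetter : Set where
  sᴴ tᴴ uᴴ vᴴ αᴴ βᴴ : HLetter

hgen : HLetter → Perm
hgen sᴴ = s
hgen tᴴ = t
hgen uᴴ = u
hgen vᴴ = v
hgen αᴴ = α
hgen βᴴ = β

hword : List HLetter → Perm
hword = word hgen

first second : STLetter → HLetter
first ṡ = sᴴ
first ṫ = tᴴ
second ṡ = uᴴ
second ṫ = vᴴ

abstract
  u≈ : u ≈ onY sᴾ
  u≈ = ≈-by-evaluation u (onY sᴾ)

  v≈ : v ≈ onY tᴾ
  v≈ = ≈-by-evaluation v (onY tᴾ)

hword-first : ∀ w x y → hword (map first w) (x , y) ≡ (runST w x , y)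
hword-first [] x y = refl
hword-first (ṡ ∷ w) x y = hword-first w (sᴾ x) y
hword-first (ṫ ∷ w) x y = hword-first w (tᴾ x) y

hword-second : ∀ w x y → hword (map second w) (x , y) ≡ (x , runST w y)
hword-second [] x y = refl
hword-second (ṡ ∷ w) x y = trans (cong (hword (map second w)) (u≈ (x , y))) (hword-second w x (sᴾ y))
hword-second (ṫ ∷ w) x y = trans (cong (hword (map second w)) (v≈ (x , y))) (hword-second w x (tᴾ y))

infixl 7 _◁_
_◁_ : Lab → HLetter → Lab
(j , k) ◁ sᴴ = target sTable j , k
(j , k) ◁ tᴴ = target tTable j , k
(j , k) ◁ uᴴ = j , target sTable k
(j , k) ◁ vᴴ = j , target tTable k
(j , k) ◁ αᴴ = target αTable j , target αTable k
(j , k) ◁ βᴴ = k , j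

-- The H-part of ⟦ l ⟧ · hgen h (a Schreier generator of the transversal R).
schreier : Lab → HLetter → List HLetter
schreier (j , k) sᴴ = map first (witness sTable j)
schreier (j , k) tᴴ = map first (witness tTable j)
schreier (j , k) uᴴ = map second (witness sTable k)
schreier (j , k) vᴴ = map second (witness tTable k)
schreier (j , k) αᴴ = map first (witness αTable j) ++ map second (witness αTable k) ++ αᴴ ∷ []
schreier (j , k) βᴴ = βᴴ ∷ []

factor-first : ∀ f table → Factorisation f id table → ∀ j k x y →
               (f (affine j x) , affine k y) ≡ ⟦ target table j , k ⟧ (hword (map first (witness table j)) (x , y))
factor-first f table factorises j k x y =
  trans (cong (_, affine k y) (factorises j x))
        (cong ⟦ target table j , k ⟧ (sym (hword-first (witness table j) x y)))

factor-second : ∀ f table → Factorisation f id table → ∀ j k x y →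
                (affine j x , f (affine k y)) ≡ ⟦ j , target table k ⟧ (hword (map second (witness table k)) (x , y))
factor-second f table factorises j k x y =
  trans (cong (affine j x ,_) (factorises k y))
        (cong ⟦ j , target table k ⟧ (sym (hword-second (witness table k) x y)))

◁-factor : ∀ l h → ⟦ l ⟧ · hgen h ≈ hword (schreier l h) · ⟦ l ◁ h ⟧
◁-factor (j , k) sᴴ (x , y) = factor-first sᴾ sTable sTable-factorises j k x y
◁-factor (j , k) tᴴ (x , y) = factor-first tᴾ tTable tTable-factorises j k x y
◁-factor (j , k) uᴴ (x , y) = trans (u≈ (affine j x , affine k y)) (factor-second sᴾ sTable sTable-factorises j k x y)
◁-factor (j , k) vᴴ (x , y) = trans (v≈ (affine j x , affine k y)) (factor-second tᴾ tTable tTable-factorises j k x y)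
◁-factor (j , k) αᴴ (x , y) = begin
  αᴾ (affine j x) , αᴾ (affine k y)
    ≡⟨ cong₂ _,_ (αTable-factorises j x) (αTable-factorises k y) ⟩
  ⟦ (j , k) ◁ αᴴ ⟧ (α (runST wj x , runST wk y))
    ≡⟨ cong ⟦ (j , k) ◁ αᴴ ⟧ (sym moved) ⟩
  ⟦ (j , k) ◁ αᴴ ⟧ (hword (schreier (j , k) αᴴ) (x , y)) ∎
  where
  open ≡-Reasoning
  wj = witness αTable j
  wk = witness αTable k
  moved : hword (schreier (j , k) αᴴ) (x , y) ≡ α (runST wj x , runST wk y)
  moved = begin
    hword (map first wj ++ map second wk ++ αᴴ ∷ []) (x , y)
      ≡⟨ word-++ hgen (map first wj) (map second wk ++ αᴴ ∷ []) (x , y) ⟩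
    hword (map second wk ++ αᴴ ∷ []) (hword (map first wj) (x , y))
      ≡⟨ word-++ hgen (map second wk) (αᴴ ∷ []) (hword (map first wj) (x , y)) ⟩
    α (hword (map second wk) (hword (map first wj) (x , y)))
      ≡⟨ cong (λ z → α (hword (map second wk) z)) (hword-first wj x y) ⟩
    α (hword (map second wk) (runST wj x , y))
      ≡⟨ cong α (hword-second wk (runST wj x) y) ⟩
    α (runST wj x , runST wk y) ∎
◁-factor (j , k) βᴴ (x , y) = refl

module Transversal {X : Set} (gen : X → Perm) (_◃_ : Lab → X → Lab)
                   (cocycle : Lab → X → List HLetter)
                   (factor : ∀ l x → ⟦ l ⟧ · gen x ≈ hword (cocycle l x) · ⟦ l ◃ x ⟧) where

  infixl 7 _◃*_
  _◃*_ : Lab → List X → Lab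
  l ◃* [] = l
  l ◃* (x ∷ xs) = l ◃ x ◃* xs

  cocycle* : Lab → List X → List HLetter
  cocycle* l [] = []
  cocycle* l (x ∷ xs) = cocycle l x ++ cocycle* (l ◃ x) xs

  factor* : ∀ l xs → ⟦ l ⟧ · word gen xs ≈ hword (cocycle* l xs) · ⟦ l ◃* xs ⟧
  factor* l [] z = refl
  factor* l (x ∷ xs) z = begin
    word gen xs (gen x (⟦ l ⟧ z))
      ≡⟨ cong (word gen xs) (factor l x z) ⟩
    word gen xs (⟦ l ◃ x ⟧ (hword (cocycle l x) z))
      ≡⟨ factor* (l ◃ x) xs (hword (cocycle l x) z) ⟩
    ⟦ l ◃* (x ∷ xs) ⟧ (hword (cocycle* (l ◃ x) xs) (hword (cocycle l x) z))
      ≡⟨ cong ⟦ l ◃* (x ∷ xs) ⟧ (sym (word-++ hgen (cocycle l x) (cocycle* (l ◃ x) xs) z)) ⟩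
    ⟦ l ◃* (x ∷ xs) ⟧ (hword (cocycle* l (x ∷ xs)) z) ∎
    where open ≡-Reasoning

open Transversal hgen _◁_ schreier ◁-factor
  renaming (_◃*_ to _◁*_; cocycle* to schreier*; factor* to ◁*-factor)

-- The generators of G in R are represented by their labels.
GLetter : Set
GLetter = Lab ⊎ HLetter

ggen : GLetter → Perm
ggen (inj₁ m) = ⟦ m ⟧
ggen (inj₂ h) = hgen h

_◁ᴳ_ : Lab → GLetter → Lab
l ◁ᴳ inj₁ m = l ⋆ m
l ◁ᴳ inj₂ h = l ◁ h

schreierᴳ : Lab → GLetter → List HLetter
schreierᴳ l (inj₁ m) = []
schreierᴳ l (inj₂ h) = schreier l h

◁ᴳ-factor : ∀ l x → ⟦ l ⟧ · ggen x ≈ hword (schreierᴳ l x) · ⟦ l ◁ᴳ x ⟧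
◁ᴳ-factor l (inj₁ m) = ⟦⟧-⋆ l m
◁ᴳ-factor l (inj₂ h) = ◁-factor l h

open Transversal ggen _◁ᴳ_ schreierᴳ ◁ᴳ-factor
  renaming (_◃*_ to _◁ᴳ*_; cocycle* to schreierᴳ*; factor* to ◁ᴳ*-factor)

-- Each right coset of H contains at most one element of R

∀HLetter? : {Q : HLetter → Set} → ((h : HLetter) → Dec (Q h)) → Dec ((h : HLetter) → Q h)
∀HLetter? Q? = map′
  (λ { (qs , qt , qu , qv , qα , qβ) → λ { sᴴ → qs ; tᴴ → qt ; uᴴ → qu ; vᴴ → qv ; αᴴ → qα ; βᴴ → qβ } })
  (λ q → q sᴴ , q tᴴ , q uᴴ , q vᴴ , q αᴴ , q βᴴ)
  (Q? sᴴ ×-dec Q? tᴴ ×-dec Q? uᴴ ×-dec Q? vᴴ ×-dec Q? αᴴ ×-dec Q? βᴴ)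

σ : Perm
σ (x , y) = σᴾ x , σᴾ y

abstract
  hgen-σ : ∀ h z → hgen h (σ z) ≡ σ (hgen h z)
  hgen-σ = toWitness {a? = ∀HLetter? λ h → ∀Point? λ z → hgen h (σ z) ≟Pt σ (hgen h z)} tt

hword-σ : ∀ hs z → hword hs (σ z) ≡ σ (hword hs z)
hword-σ [] z = refl
hword-σ (h ∷ hs) z = trans (cong (hword hs) (hgen-σ h z)) (hword-σ hs (hgen h z))

conjugate : Lab → Perm
conjugate l z = ⟦ l ⟧ (σ (⟦ l ⁻¹ ⟧ z))

conjugate-coset-invariant : ∀ hs l l′ → hword hs · ⟦ l ⟧ ≈ ⟦ l′ ⟧ → conjugate l′ ≈ conjugate l
conjugate-coset-invariant hs l l′ same z = begin
  ⟦ l′ ⟧ (σ y)                           ≡⟨ sym (same (σ y)) ⟩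
  ⟦ l ⟧ (hword hs (σ y))                 ≡⟨ cong ⟦ l ⟧ (hword-σ hs y) ⟩
  ⟦ l ⟧ (σ (hword hs y))                 ≡⟨ cong (λ w → ⟦ l ⟧ (σ w)) (sym (⟦⟧-inverseˡ l (hword hs y))) ⟩
  ⟦ l ⟧ (σ (⟦ l ⁻¹ ⟧ (⟦ l ⟧ (hword hs y)))) ≡⟨ cong (λ w → ⟦ l ⟧ (σ (⟦ l ⁻¹ ⟧ w))) (same y) ⟩
  ⟦ l ⟧ (σ (⟦ l ⁻¹ ⟧ (⟦ l′ ⟧ y)))        ≡⟨ cong (λ w → ⟦ l ⟧ (σ (⟦ l ⁻¹ ⟧ w))) (⟦⟧-inverseʳ l′ z) ⟩
  ⟦ l ⟧ (σ (⟦ l ⁻¹ ⟧ z))                 ∎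
  where
  open ≡-Reasoning
  y = ⟦ l′ ⁻¹ ⟧ z

conjugateᵃ : Aff → P → P
conjugateᵃ j p = affine j (σᴾ (affine (j ⁻¹ᵃ) p))

abstract
  conjugateᵃ-injective : ∀ j k → (∀ p → conjugateᵃ j p ≡ conjugateᵃ k p) → j ≡ k
  conjugateᵃ-injective = toWitness
    {a? = all? λ j → all? λ k → (∀P? λ p → conjugateᵃ j p ≟P conjugateᵃ k p) →-dec (j ≟ᵃ k)} tt

coset-representative-unique : ∀ hs l l′ → hword hs · ⟦ l ⟧ ≈ ⟦ l′ ⟧ → l ≡ l′
coset-representative-unique hs (j , k) (j′ , k′) same =
  cong₂ _,_ (conjugateᵃ-injective j j′ λ p → cong proj₁ (conjugates-agree p))
            (conjugateᵃ-injective k k′ λ p → cong proj₂ (conjugates-agree p))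
  where
  conjugates-agree : ∀ p → conjugate (j , k) (p , p) ≡ conjugate (j′ , k′) (p , p)
  conjugates-agree p = sym (conjugate-coset-invariant hs (j , k) (j′ , k′) same (p , p))

H-generator : ∀ {g} → g ∈ Hgens → Σ HLetter λ h → hgen h ≡ g
H-generator (here refl) = sᴴ , refl
H-generator (there (here refl)) = tᴴ , refl
H-generator (there (there (here refl))) = uᴴ , refl
H-generator (there (there (there (here refl)))) = vᴴ , refl
H-generator (there (there (there (there (here refl))))) = αᴴ , refl
H-generator (there (there (there (there (there (here refl)))))) = βᴴ , refl

hgen-letter : ∀ h → Letter Hgens (hgen h)
hgen-letter sᴴ = gen (here refl)
hgen-letter tᴴ = gen (there (here refl))
hgen-letter uᴴ = gen (there (there (here refl)))
hgen-letter vᴴ = gen (there (there (there (here refl))))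
hgen-letter αᴴ = gen (there (there (there (there (here refl)))))
hgen-letter βᴴ = gen (there (there (there (there (there (here refl))))))

InH-hword : ∀ {f} hs → hword hs ≈ f → InH f
InH-hword hs hs≈f = map hgen hs , letters hs , hs≈f
  where
  letters : ∀ hs → All (Letter Hgens) (map hgen hs)
  letters [] = []
  letters (h ∷ hs) = hgen-letter h ∷ letters hs

-- s and u have order 4; t, v, α and β are involutions.
letter-inverse : HLetter → List HLetter
letter-inverse sᴴ = sᴴ ∷ sᴴ ∷ sᴴ ∷ []
letter-inverse uᴴ = uᴴ ∷ uᴴ ∷ uᴴ ∷ []
letter-inverse h = h ∷ []

abstract
  letter-inverseˡ : ∀ h z → hword (letter-inverse h) (hgen h z) ≡ z
  letter-inverseˡ = toWitness {a? = ∀HLetter? λ h → ∀Point? λ z → hword (letter-inverse h) (hgen h z) ≟Pt z} tt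

  letter-inverseʳ : ∀ h z → hgen h (hword (letter-inverse h) z) ≡ z
  letter-inverseʳ = toWitness {a? = ∀HLetter? λ h → ∀Point? λ z → hgen h (hword (letter-inverse h) z) ≟Pt z} tt

inv-hgen : ∀ h → inv (hgen h) ≈ hword (letter-inverse h)
inv-hgen h = inv-unique (hgen h) (hword (letter-inverse h)) (letter-inverseˡ h) (letter-inverseʳ h)

word-inverse : List HLetter → List HLetter
word-inverse [] = []
word-inverse (h ∷ hs) = word-inverse hs ++ letter-inverse h

word-inverse-cancel : ∀ hs z → hword hs (hword (word-inverse hs) z) ≡ z
word-inverse-cancel [] z = refl
word-inverse-cancel (h ∷ hs) z = begin
  hword hs (hgen h (hword (word-inverse hs ++ letter-inverse h) z))
    ≡⟨ cong (λ w → hword hs (hgen h w)) (word-++ hgen (word-inverse hs) (letter-inverse h) z) ⟩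
  hword hs (hgen h (hword (letter-inverse h) (hword (word-inverse hs) z)))
    ≡⟨ cong (hword hs) (letter-inverseʳ h (hword (word-inverse hs) z)) ⟩
  hword hs (hword (word-inverse hs) z)
    ≡⟨ word-inverse-cancel hs z ⟩
  z ∎
  where open ≡-Reasoning

spell-H-letter : ∀ {g} → Letter Hgens g → Σ (List HLetter) λ hs → hword hs ≈ g
spell-H-letter (gen g∈) with H-generator g∈
... | h , refl = h ∷ [] , λ _ → refl
spell-H-letter (gen⁻ g∈) with H-generator g∈
... | h , refl = letter-inverse h , λ z → sym (inv-hgen h z)

spell-H : ∀ {f} → InH f → Σ (List HLetter) λ hs → hword hs ≈ f
spell-H (w , letters , w≈f) with spell hgen spell-H-letter letters
... | hs , hs≈w = hs , λ z → trans (hs≈w z) (w≈f z)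

G-generator : ∀ {g} → g ∈ Ggens → Labelled g ⊎ Σ HLetter λ h → hgen h ≡ g
G-generator (here refl) = inj₁ (aᴸ , a≈)
G-generator (there (here refl)) = inj₁ (bᴸ , b≈)
G-generator (there (there (here refl))) = inj₁ (cᴸ , c≈)
G-generator (there (there (there (here refl)))) = inj₁ (dᴸ , d≈)
G-generator (there (there (there (there (here refl))))) = inj₂ (tᴴ , refl)
G-generator (there (there (there (there (there (here refl)))))) = inj₂ (vᴴ , refl)
G-generator (there (there (there (there (there (there (here refl))))))) = inj₂ (αᴴ , refl)
G-generator (there (there (there (there (there (there (there (here refl)))))))) = inj₂ (βᴴ , refl)

word-inj₂ : ∀ hs z → word ggen (map inj₂ hs) z ≡ hword hs z
word-inj₂ [] z = refl
word-inj₂ (h ∷ hs) z = word-inj₂ hs (hgen h z)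

spell-G-letter : ∀ {g} → Letter Ggens g → Σ (List GLetter) λ xs → word ggen xs ≈ g
spell-G-letter (gen g∈) with G-generator g∈
... | inj₁ (m , g≈m) = inj₁ m ∷ [] , λ z → sym (g≈m z)
... | inj₂ (h , refl) = inj₂ h ∷ [] , λ _ → refl
spell-G-letter (gen⁻ g∈) with G-generator g∈
... | inj₁ (m , g≈m) = inj₁ (m ⁻¹) ∷ [] , λ z → sym (inv-⟦⟧ m g≈m z)
... | inj₂ (h , refl) = map inj₂ (letter-inverse h) ,
                        λ z → trans (word-inj₂ (letter-inverse h) z) (sym (inv-hgen h z))

infixr 8 _^ᴸ_
_^ᴸ_ : Lab → ℕ → Lab
l ^ᴸ zero = ε
l ^ᴸ suc n = l ⋆ l ^ᴸ n

swap : Lab → Lab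
swap (j , k) = k , j

_⊗ᴸ_ : List Lab → List Lab → List Lab
X ⊗ᴸ Y = concatMap (λ x → map (x ⋆_) Y) X

S₁ᴸ S₂ᴸ S₃ᴸ S₄ᴸ S₁±ᴸ S₃±ᴸ Sᴸ : List Lab
S₁ᴸ = aᴸ ∷ aᴸ ^ᴸ 5 ∷ aᴸ ^ᴸ 6 ⋆ bᴸ ∷ aᴸ ^ᴸ 6 ⋆ bᴸ ^ᴸ 2 ∷ []
S₂ᴸ = aᴸ ⋆ bᴸ ∷ (aᴸ ⋆ bᴸ) ⁻¹ ∷ []
S₃ᴸ = aᴸ ^ᴸ 3 ∷ bᴸ ∷ aᴸ ⋆ bᴸ ^ᴸ 2 ∷ aᴸ ^ᴸ 4 ⋆ bᴸ ^ᴸ 2 ∷ []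
S₄ᴸ = aᴸ ^ᴸ 2 ⋆ bᴸ ∷ (aᴸ ^ᴸ 2 ⋆ bᴸ) ⁻¹ ∷ []
S₁±ᴸ = S₁ᴸ ++ map _⁻¹ S₁ᴸ
S₃±ᴸ = S₃ᴸ ++ map _⁻¹ S₃ᴸ
Sᴸ = (S₁±ᴸ ⊗ᴸ map swap S₃±ᴸ) ++ (S₃±ᴸ ⊗ᴸ map swap S₁±ᴸ) ++ (S₁ᴸ ⊗ᴸ map swap S₂ᴸ)
  ++ (S₂ᴸ ⊗ᴸ map swap S₁ᴸ) ++ (map _⁻¹ S₁ᴸ ⊗ᴸ map swap S₄ᴸ) ++ (S₄ᴸ ⊗ᴸ map swap (map _⁻¹ S₁ᴸ))

Labels : List Perm → List Lab → Set
Labels = Pointwise λ f l → f ≈ ⟦ l ⟧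

≈⟦⟧-· : ∀ {f g} l m → f ≈ ⟦ l ⟧ → g ≈ ⟦ m ⟧ → f · g ≈ ⟦ l ⋆ m ⟧
≈⟦⟧-· l m f≈l g≈m = proj₂ (labelled-· (l , f≈l) (m , g≈m))

≈⟦⟧-^ : ∀ {f} l → f ≈ ⟦ l ⟧ → ∀ n → f ^ n ≈ ⟦ l ^ᴸ n ⟧
≈⟦⟧-^ l f≈l zero z = sym (⟦ε⟧ z)
≈⟦⟧-^ l f≈l (suc n) = ≈⟦⟧-· l (l ^ᴸ n) f≈l (≈⟦⟧-^ l f≈l n)

≈⟦⟧-γ : ∀ {f} l → f ≈ ⟦ l ⟧ → γ f ≈ ⟦ swap l ⟧
≈⟦⟧-γ {f} (j , k) f≈l (x , y) = cong β (trans (cong f (inv-β (x , y))) (f≈l (y , x)))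
  where
  inv-β : inv β ≈ β
  inv-β = inv-unique β β (λ _ → refl) (λ _ → refl)

labels-map : ∀ {f : Perm → Perm} {g : Lab → Lab} → (∀ {x m} → x ≈ ⟦ m ⟧ → f x ≈ ⟦ g m ⟧) →
             ∀ {X Xᴸ} → Labels X Xᴸ → Labels (map f X) (map g Xᴸ)
labels-map f≈g [] = []
labels-map f≈g (x≈m ∷ X≈) = f≈g x≈m ∷ labels-map f≈g X≈

labels-⊗ : ∀ {X Xᴸ Y Yᴸ} → Labels X Xᴸ → Labels Y Yᴸ → Labels (X ⊗ Y) (Xᴸ ⊗ᴸ Yᴸ)
labels-⊗ [] Y≈ = []
labels-⊗ {Xᴸ = m ∷ _} (x≈m ∷ X≈) Y≈ = ++⁺ (labels-map (λ {_} {n} → ≈⟦⟧-· m n x≈m) Y≈) (labels-⊗ X≈ Y≈)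

labels-inv : ∀ {X Xᴸ} → Labels X Xᴸ → Labels (invs X) (map _⁻¹ Xᴸ)
labels-inv = labels-map λ {_} {m} → inv-⟦⟧ m

labels-γ : ∀ {X Xᴸ} → Labels X Xᴸ → Labels (X ᵞ) (map swap Xᴸ)
labels-γ = labels-map λ {_} {m} → ≈⟦⟧-γ m

Sᴸ-labels : Labels Sconn Sᴸ
Sᴸ-labels =
  ++⁺ (labels-⊗ S₁±≈ (labels-γ S₃±≈)) (++⁺ (labels-⊗ S₃±≈ (labels-γ S₁±≈))
    (++⁺ (labels-⊗ S₁≈ (labels-γ S₂≈)) (++⁺ (labels-⊗ S₂≈ (labels-γ S₁≈))
      (++⁺ (labels-⊗ (labels-inv S₁≈) (labels-γ S₄≈)) (labels-⊗ S₄≈ (labels-γ (labels-inv S₁≈)))))))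
  where
  aⁱbʲ : ∀ i j → (a ^ i) · (b ^ j) ≈ ⟦ aᴸ ^ᴸ i ⋆ bᴸ ^ᴸ j ⟧
  aⁱbʲ i j = ≈⟦⟧-· (aᴸ ^ᴸ i) (bᴸ ^ᴸ j) (≈⟦⟧-^ aᴸ a≈ i) (≈⟦⟧-^ bᴸ b≈ j)
  a^ : ∀ i → a ^ i ≈ ⟦ aᴸ ^ᴸ i ⟧
  a^ = ≈⟦⟧-^ aᴸ a≈
  aⁱb : ∀ i → (a ^ i) · b ≈ ⟦ aᴸ ^ᴸ i ⋆ bᴸ ⟧
  aⁱb i = ≈⟦⟧-· (aᴸ ^ᴸ i) bᴸ (a^ i) b≈
  ab : a · b ≈ ⟦ aᴸ ⋆ bᴸ ⟧
  ab = ≈⟦⟧-· aᴸ bᴸ a≈ b≈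
  S₁≈ : Labels S₁ S₁ᴸ
  S₁≈ = a≈ ∷ a^ 5 ∷ aⁱb 6 ∷ aⁱbʲ 6 2 ∷ []
  S₂≈ : Labels S₂ S₂ᴸ
  S₂≈ = ab ∷ inv-⟦⟧ (aᴸ ⋆ bᴸ) ab ∷ []
  S₃≈ : Labels S₃ S₃ᴸ
  S₃≈ = a^ 3 ∷ b≈ ∷ ≈⟦⟧-· aᴸ (bᴸ ^ᴸ 2) a≈ (≈⟦⟧-^ bᴸ b≈ 2) ∷ aⁱbʲ 4 2 ∷ []
  S₄≈ : Labels S₄ S₄ᴸ
  S₄≈ = aⁱb 2 ∷ inv-⟦⟧ (aᴸ ^ᴸ 2 ⋆ bᴸ) (aⁱb 2) ∷ []
  S₁±≈ : Labels S₁± S₁±ᴸ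
  S₁±≈ = ++⁺ S₁≈ (labels-inv S₁≈)
  S₃±≈ : Labels S₃± S₃±ᴸ
  S₃±≈ = ++⁺ S₃≈ (labels-inv S₃≈)

labels-Any : ∀ {X Xᴸ f} → Labels X Xᴸ → Any (λ x → f ≈ x) X → Σ Lab λ m → m ∈ Xᴸ × f ≈ ⟦ m ⟧
labels-Any (x≈m ∷ _) (here f≈x) = _ , here refl , λ z → trans (f≈x z) (x≈m z)
labels-Any (_ ∷ X≈) (there f∈X) with labels-Any X≈ f∈X
... | m , m∈ , f≈m = m , there m∈ , f≈m

labels-∈ : ∀ {X Xᴸ m} → Labels X Xᴸ → m ∈ Xᴸ → Any (λ x → x ≈ ⟦ m ⟧) X
labels-∈ (x≈m ∷ _) (here refl) = here x≈m
labels-∈ (_ ∷ X≈) (there m∈) = there (labels-∈ X≈ m∈)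

-- The double coset D = Hg₁H ∪ Hg₂H meets R exactly in S

data Rep : Set where
  r₁ r₂ : Rep

rep : Rep → Perm
rep r₁ = g₁
rep r₂ = g₂

repᴸ : Rep → Lab
repᴸ r₁ = # 4 , # 5
repᴸ r₂ = # 2 , # 19

abstract
  rep≈ : ∀ i → rep i ≈ ⟦ repᴸ i ⟧
  rep≈ r₁ = ≈-by-evaluation g₁ ⟦ repᴸ r₁ ⟧
  rep≈ r₂ = ≈-by-evaluation g₂ ⟦ repᴸ r₂ ⟧

InD-intro : ∀ {f} i {h h′} → InH h → InH h′ → f ≈ h · rep i · h′ → InD f
InD-intro r₁ h∈H h′∈H f≈ = _ , _ , h∈H , h′∈H , inj₁ f≈
InD-intro r₂ h∈H h′∈H f≈ = _ , _ , h∈H , h′∈H , inj₂ f≈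

InD-elim : ∀ {f} → InD f → Σ Rep λ i → Σ Perm λ h → Σ Perm λ h′ → InH h × InH h′ × f ≈ h · rep i · h′
InD-elim (h , h′ , h∈H , h′∈H , inj₁ f≈) = r₁ , h , h′ , h∈H , h′∈H , f≈
InD-elim (h , h′ , h∈H , h′∈H , inj₂ f≈) = r₂ , h , h′ , h∈H , h′∈H , f≈

InD-cong : ∀ {f g} → f ≈ g → InD g → InD f
InD-cong f≈g g∈D with InD-elim g∈D
... | i , _ , _ , h∈H , h′∈H , g≈ = InD-intro i h∈H h′∈H λ z → trans (f≈g z) (g≈ z)

reached-InD : ∀ i hs → InD ⟦ repᴸ i ◁* hs ⟧
reached-InD i hs = InD-intro i (InH-hword (word-inverse ks) λ _ → refl) (InH-hword hs λ _ → refl) λ z → sym (begin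
  hword hs (rep i (hword (word-inverse ks) z))       ≡⟨ cong (hword hs) (rep≈ i (hword (word-inverse ks) z)) ⟩
  hword hs (⟦ repᴸ i ⟧ (hword (word-inverse ks) z))  ≡⟨ ◁*-factor (repᴸ i) hs (hword (word-inverse ks) z) ⟩
  ⟦ repᴸ i ◁* hs ⟧ (hword ks (hword (word-inverse ks) z)) ≡⟨ cong ⟦ repᴸ i ◁* hs ⟧ (word-inverse-cancel ks z) ⟩
  ⟦ repᴸ i ◁* hs ⟧ z                                 ∎)
  where
  open ≡-Reasoning
  ks = schreier* (repᴸ i) hs

-- Sᴸ is the union of eight blocks O × O′ of ⟨s,t⟩-orbits on Aff.  Entry j of kTable
-- is (b , w) with b the least element of the orbit of j and w a word leading from b to j;
-- sBlock b b′ is defined exactly on the blocks of Sᴸ, where it gives a word leading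
-- from g₁ or g₂ to (b , b′).
kTable : Vec (ℕ × List STLetter) 21
kTable =
    (0  , [])
  ∷ (1  , [])
  ∷ (2  , [])
  ∷ (3  , [])
  ∷ (3  , ṡ ∷ ṡ ∷ ṡ ∷ [])
  ∷ (1  , ṫ ∷ [])
  ∷ (2  , ṫ ∷ ṡ ∷ [])
  ∷ (3  , ṡ ∷ ṡ ∷ ṫ ∷ [])
  ∷ (2  , ṡ ∷ [])
  ∷ (9  , [])
  ∷ (3  , ṡ ∷ ṫ ∷ [])
  ∷ (11 , [])
  ∷ (1  , ṡ ∷ ṡ ∷ [])
  ∷ (3  , ṫ ∷ [])
  ∷ (3  , ṡ ∷ ṡ ∷ [])
  ∷ (2  , ṫ ∷ [])
  ∷ (3  , ṫ ∷ ṡ ∷ [])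
  ∷ (1  , ṡ ∷ [])
  ∷ (3  , ṡ ∷ [])
  ∷ (11 , ṡ ∷ [])
  ∷ (9  , ṡ ∷ [])
  ∷ []

sBlock : ℕ → ℕ → Maybe (Rep × List HLetter)
sBlock 3 1 = just (r₁ , sᴴ ∷ uᴴ ∷ [])
sBlock 1 3 = just (r₁ , sᴴ ∷ uᴴ ∷ βᴴ ∷ [])
sBlock 3 2 = just (r₁ , αᴴ ∷ sᴴ ∷ uᴴ ∷ [])
sBlock 2 3 = just (r₁ , αᴴ ∷ sᴴ ∷ uᴴ ∷ βᴴ ∷ [])
sBlock 2 11 = just (r₂ , uᴴ ∷ [])
sBlock 11 2 = just (r₂ , uᴴ ∷ βᴴ ∷ [])
sBlock 1 9 = just (r₂ , tᴴ ∷ αᴴ ∷ [])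
sBlock 9 1 = just (r₂ , tᴴ ∷ αᴴ ∷ βᴴ ∷ [])
sBlock _ _ = nothing

blockOf : Lab → Maybe (Rep × List HLetter)
blockOf (j , k) = sBlock (proj₁ (lookup kTable j)) (proj₁ (lookup kTable k))

InBlocks : Lab → Set
InBlocks l = T (is-just (blockOf l))

path : Lab → Rep × List HLetter
path (j , k) = proj₁ prefix ,
  proj₂ prefix ++ map first (proj₂ (lookup kTable j)) ++ map second (proj₂ (lookup kTable k))
  where
  prefix = fromMaybe (r₁ , []) (blockOf (j , k))

open import Data.List.Membership.DecPropositional _≟ᴸ_ using (_∈?_)

abstract
  path-reaches : ∀ {l} → l ∈ Sᴸ → repᴸ (proj₁ (path l)) ◁* proj₂ (path l) ≡ l
  path-reaches = All.lookup (toWitness {a? = All.all? (λ l → repᴸ (proj₁ (path l)) ◁* proj₂ (path l) ≟ᴸ l) Sᴸ} tt)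

  InBlocks-closed : ∀ l → InBlocks l → ∀ h → InBlocks (l ◁ h)
  InBlocks-closed = toWitness
    {a? = ∀Lab? λ l → T? (is-just (blockOf l)) →-dec ∀HLetter? λ h → T? (is-just (blockOf (l ◁ h)))} tt

  InBlocks⊆Sᴸ : ∀ l → InBlocks l → l ∈ Sᴸ
  InBlocks⊆Sᴸ = toWitness {a? = ∀Lab? λ l → T? (is-just (blockOf l)) →-dec (l ∈? Sᴸ)} tt

InBlocks-rep : ∀ i → InBlocks (repᴸ i)
InBlocks-rep r₁ = tt
InBlocks-rep r₂ = tt

InBlocks-closed* : ∀ {l} → InBlocks l → ∀ hs → InBlocks (l ◁* hs)
InBlocks-closed* l∈B [] = l∈B
InBlocks-closed* {l} l∈B (h ∷ hs) = InBlocks-closed* (InBlocks-closed l l∈B h) hs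

S⊆D : ∀ {l} → l ∈ Sᴸ → InD ⟦ l ⟧
S⊆D {l} l∈S = subst (λ m → InD ⟦ m ⟧) (path-reaches l∈S) (reached-InD (proj₁ (path l)) (proj₂ (path l)))

D⊆S : ∀ l → InD ⟦ l ⟧ → l ∈ Sᴸ
D⊆S l l∈D with InD-elim l∈D
... | i , h , h′ , h∈H , h′∈H , l≈ with spell-H h∈H | spell-H h′∈H
... | hs , hs≈h | hs′ , hs′≈h′ =
  subst (_∈ Sᴸ) (coset-representative-unique (hs ++ ks) m l factor)
        (InBlocks⊆Sᴸ m (InBlocks-closed* (InBlocks-rep i) hs′))
  where
  open ≡-Reasoning
  ks = schreier* (repᴸ i) hs′
  m = repᴸ i ◁* hs′
  factor : hword (hs ++ ks) · ⟦ m ⟧ ≈ ⟦ l ⟧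
  factor z = begin
    ⟦ m ⟧ (hword (hs ++ ks) z)          ≡⟨ cong ⟦ m ⟧ (word-++ hgen hs ks z) ⟩
    ⟦ m ⟧ (hword ks (hword hs z))       ≡⟨ sym (◁*-factor (repᴸ i) hs′ (hword hs z)) ⟩
    hword hs′ (⟦ repᴸ i ⟧ (hword hs z)) ≡⟨ cong (hword hs′) (sym (rep≈ i (hword hs z))) ⟩
    hword hs′ (rep i (hword hs z))      ≡⟨ hs′≈h′ (rep i (hword hs z)) ⟩
    h′ (rep i (hword hs z))             ≡⟨ cong (λ w → h′ (rep i w)) (hs≈h z) ⟩
    h′ (rep i (h z))                    ≡⟨ sym (l≈ z) ⟩
    ⟦ l ⟧ z                             ∎

same-coset-of-≈ : ∀ {r r′} → Labelled r → r ≈ r′ → SameCoset r r′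
same-coset-of-≈ {r} r∈R r≈r′ = [] , [] , λ z → sym (trans (cong (inv r) (sym (r≈r′ z))) (inv-cancelˡ r∈R z))

coset-injective : ∀ {r r′} → Labelled r → Labelled r′ → SameCoset r r′ → r ≈ r′
coset-injective {r} {r′} (l , r≈l) (l′ , r′≈l′) same with spell-H same
... | hs , hs≈ = λ z → trans (r≈l z) (trans (cong (λ m → ⟦ m ⟧ z) l≡l′) (sym (r′≈l′ z)))
  where
  open ≡-Reasoning
  l≡l′ : l ≡ l′
  l≡l′ = coset-representative-unique hs l l′ λ z → begin
    ⟦ l ⟧ (hword hs z)   ≡⟨ cong ⟦ l ⟧ (hs≈ z) ⟩
    ⟦ l ⟧ (inv r (r′ z)) ≡⟨ sym (r≈l (inv r (r′ z))) ⟩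
    r (inv r (r′ z))     ≡⟨ inv-cancelʳ (l , r≈l) (r′ z) ⟩
    r′ z                 ≡⟨ r′≈l′ z ⟩
    ⟦ l′ ⟧ z             ∎

coset-representative : ∀ {g} → InG g → Σ Perm λ r → Σ (InR r) λ _ → SameCoset r g
coset-representative {g} (w , letters , w≈g) with spell ggen spell-G-letter letters
... | xs , xs≈w = ⟦ m ⟧ , ⟦⟧∈R m , InH-hword ks λ z → begin
    hword ks z                       ≡⟨ sym (inv-cancelˡ (m , λ _ → refl) (hword ks z)) ⟩
    inv ⟦ m ⟧ (⟦ m ⟧ (hword ks z))   ≡⟨ cong (inv ⟦ m ⟧) (sym (◁ᴳ*-factor ε xs z)) ⟩
    inv ⟦ m ⟧ (word ggen xs (⟦ ε ⟧ z)) ≡⟨ cong (λ y → inv ⟦ m ⟧ (word ggen xs y)) (⟦ε⟧ z) ⟩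
    inv ⟦ m ⟧ (word ggen xs z)       ≡⟨ cong (inv ⟦ m ⟧) (trans (xs≈w z) (w≈g z)) ⟩
    inv ⟦ m ⟧ (g z)                  ∎
  where
  open ≡-Reasoning
  m = ε ◁ᴳ* xs
  ks = schreierᴳ* ε xs

Cay⇒Cos : ∀ {r r′} → CayArc r r′ → CosArc r r′
Cay⇒Cos arc = let m , m∈S , arc≈m = labels-Any Sᴸ-labels arc in InD-cong arc≈m (S⊆D m∈S)

Cos⇒Cay : ∀ {r r′} → Labelled r → Labelled r′ → CosArc r r′ → CayArc r r′
Cos⇒Cay r∈R r′∈R arc =
  let m , q≈m = labelled-· r′∈R (labelled-inv r∈R)
  in Any.map (λ x≈m z → trans (q≈m z) (sym (x≈m z)))
             (labels-∈ Sᴸ-labels (D⊆S m (InD-cong (λ z → sym (q≈m z)) arc)))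

lemma4p5 : CayCosIso
lemma4p5 = record
  { φ      = λ r _ → r
  ; φ-inG  = λ _ → R⊆G
  ; φ-wd   = λ _ p _ _ → same-coset-of-≈ (labelled-R p)
  ; φ-inj  = λ _ p _ p′ → coset-injective (labelled-R p) (labelled-R p′)
  ; φ-surj = λ _ → coset-representative
  ; φ-arc  = λ r _ r′ _ → Cay⇒Cos {r} {r′}
  ; φ-arc⁻ = λ r p r′ p′ → Cos⇒Cay {r} {r′} (labelled-R p) (labelled-R p′)
  }
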